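{- Let $c\in\{3,4\}$ and let $W$ be a double occurrence word whose interlacement graph $\mathcal{I}(W)$ is the cycle graph $C_c$. Then the vertices of $C_c$ may be indexed $v_1,\dots,v_c$ so that they appear in this order around the cycle and $W$ is cyclically equivalent to $v_1v_3v_2v_1v_3v_2$ (if $c=3$) or to $v_1v_4v_2v_1v_3v_2v_4v_3$ (if $c=4$).
   Context: A double occurrence word is a finite sequence in which each letter that appears, appears exactly twice. Its interlacement graph $\mathcal{I}(W)$ has one vertex per letter, with $a,b$ adjacent iff the letters appear in $W$ in the order $abab$ or $baba$. Two double occurrence words are cyclically equivalent if one can be obtained from the other by a sequence of cyclic permutations $w_1\dots w_{2n}\mapsto w_iw_{i+1}\dots w_{2n}w_1\dots w_{i-1}$ and reversals $w_1\dots w_{2n}\mapsto w_{2n}\dots w_1$. -}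

module Defs where

open import Data.Nat using (ℕ; suc; _%_; _≟_)
open import Relation.Nullary using (yes; no)
open import Data.Fin using (Fin; toℕ)
open import Data.List using (List; []; _∷_; _++_; reverse; map)
open import Data.List.Membership.Propositional using (_∈_)
open import Data.List.Relation.Binary.Sublist.Propositional using (_⊆_)
open import Data.List.Relation.Unary.Any using (Any)
open import Data.Product using (Σ; _×_; ∃)
open import Data.Sum using (_⊎_)
open import Data.Empty using (⊥)
open import Function using (_⇔_)
open import Function.Definitions using (Injective)
open import Relation.Binary.PropositionalEquality using (_≡_; _≢_)
open import Relation.Binary.Construct.Closure.ReflexiveTransitive using (Star)
open import Data.Fin.Patterns

Word : Set
Word = List ℕ

count : ℕ → Word → ℕ
count a [] = 0
count a (x ∷ w) with a ≟ x
... | yes _ = suc (count a w)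
... | no _ = count a w

DoubleOccurrence : Word → Set
DoubleOccurrence w = ∀ a → a ∈ w → count a w ≡ 2

Interlaced : Word → ℕ → ℕ → Set
Interlaced w a b =
  a ≢ b × ((a ∷ b ∷ a ∷ b ∷ []) ⊆ w ⊎ (b ∷ a ∷ b ∷ a ∷ []) ⊆ w)

-- adjacency in the cycle graph C_c on vertices Fin c (i ~ i+1 mod c)
-- (c = 0 has no vertices, so the case split is harmless)
CycleAdj : (c : ℕ) → Fin c → Fin c → Set
CycleAdj 0 i j = ⊥
CycleAdj (suc k) i j = toℕ j ≡ suc (toℕ i) % suc k ⊎ toℕ i ≡ suc (toℕ j) % suc k

-- v : Fin c → ℕ is a graph isomorphism from C_c onto the interlacement
-- graph I(w) (whose vertex set is the set of letters of w)
IsCycleLabelling : (c : ℕ) → Word → (Fin c → ℕ) → Set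
IsCycleLabelling c w v =
  Injective _≡_ _≡_ v ×
  (∀ i → v i ∈ w) ×
  (∀ a → a ∈ w → ∃ λ i → v i ≡ a) ×
  (∀ i j → Interlaced w (v i) (v j) ⇔ CycleAdj c i j)

InterlacementIsCycle : (c : ℕ) → Word → Set
InterlacementIsCycle c w = ∃ λ (v : Fin c → ℕ) → IsCycleLabelling c w v

data CycStep : Word → Word → Set where
  rotate  : (xs ys : Word) → CycStep (xs ++ ys) (ys ++ xs)
  rev : (xs : Word) → CycStep xs (reverse xs)

CyclicallyEquivalent : Word → Word → Set
CyclicallyEquivalent = Star CycStep

-- the normal forms, as words in the indices (0-based: v₁ ↦ 0, ..., v_c ↦ c-1)
-- c = 3 : v1 v3 v2 v1 v3 v2 ;  c = 4 : v1 v4 v2 v1 v3 v2 v4 v3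
pattern' : (c : ℕ) → List (Fin c)
pattern' 3 = 0F ∷ 2F ∷ 1F ∷ 0F ∷ 2F ∷ 1F ∷ []
pattern' 4 = 0F ∷ 3F ∷ 1F ∷ 0F ∷ 2F ∷ 1F ∷ 3F ∷ 2F ∷ []
pattern' _ = []

module Submission where

-- Relabelling the letters of W along the labelling v turns W into a word u over Fin c in which
-- every letter occurs exactly twice, so u has length 2c and there are only finitely many
-- candidates (90 for c = 3, 2520 for c = 4).  Enumerating them all, every u whose interlacement
-- graph is the cycle on 0, …, c − 1 turns out to be a rotation or reversal of the normal form
-- relabelled by a symmetry i ↦ ±i + k of the c-gon.  These symmetries are automorphisms of C_c,
-- so composing v with the symmetry found gives the required labelling.

open import Defs
open import Data.Nat using (ℕ; zero; suc; pred; _+_; _*_; _%_; _<_; _<ᵇ_; s≤s; z≤n)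
open import Data.Nat.Properties using (+-commutativeSemigroup; +-0-commutativeMonoid; m<m+n; <⇒<ᵇ)
import Data.Nat.Properties as ℕ
open import Data.Nat.DivMod using (_mod_)
open import Data.Bool using (Bool; true; false; T; if_then_else_)
open import Data.Bool.ListAction using (all)
open import Data.Unit using (tt)
open import Data.Empty using (⊥-elim)
open import Data.Fin using (Fin; toℕ; opposite; zero; suc)
open import Data.Fin.Properties using (_≟_; all?; any?)
open import Data.List using (List; []; _∷_; _++_; _ʳ++_; reverse; map; concatMap; take; drop; length; upTo; allFin)
open import Data.List.Properties using (≡-dec; map-++; map-∘; take++drop≡id; reverse-map; reverse-involutive)
open import Data.List.Membership.Propositional using (_∈_)
open import Data.List.Membership.Propositional.Properties using (∈-map⁻; ∈-++⁻; ∈-allFin)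
import Data.List.Membership.DecPropositional as DecMembership
open import Data.List.Relation.Unary.All as All using (All)
open import Data.List.Relation.Unary.All.Properties using (all⁺)
open import Data.List.Relation.Unary.Any as Any using (Any; here; there)
open import Data.List.Relation.Binary.Sublist.Propositional using (_⊆_)
open import Data.List.Relation.Binary.Sublist.Propositional.Properties using (map⁺)
import Data.List.Relation.Binary.Sublist.DecPropositional as DecSublist
import Data.List.Relation.Binary.Sublist.Heterogeneous as Sublistʰ
import Data.List.Relation.Binary.Sublist.Heterogeneous.Properties as Sublistʰ
open import Data.Product using (_×_; _,_; ∃; ∃₂; proj₁; proj₂; uncurry)
open import Data.Sum as Sum using (_⊎_; inj₁; inj₂)
open import Function using (_∘_; _⇔_; mk⇔; Equivalence)
open import Function.Definitions using (Injective)
open import Function.Construct.Composition using (_⇔-∘_)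
open import Relation.Binary.PropositionalEquality
open import Relation.Binary.Construct.Closure.ReflexiveTransitive using (ε; _◅_; _◅◅_)
open import Relation.Nullary using (Dec; yes; no; does; contradiction; ¬?)
open import Relation.Nullary.Decidable using (dec-true; map′; _×-dec_; _⊎-dec_; _→-dec_; toWitness)
open import Relation.Unary using (Decidable)
open import Algebra.Properties.CommutativeSemigroup +-commutativeSemigroup using (x∙yz≈yx∙z)
open import Algebra.Properties.CommutativeMonoid.Sum +-0-commutativeMonoid
  using (sum; ∑-distrib-+; sum-cong-≗; sum-replicate-zero)

_⇔-dec_ : ∀ {A B : Set} → Dec A → Dec B → Dec (A ⇔ B)
a? ⇔-dec b? = map′ (uncurry mk⇔) (λ e → Equivalence.to e , Equivalence.from e) ((a? →-dec b?) ×-dec (b? →-dec a?))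

InterlacedIn : ∀ {A : Set} → List A → A → A → Set
InterlacedIn w a b = a ≢ b × ((a ∷ b ∷ a ∷ b ∷ []) ⊆ w ⊎ (b ∷ a ∷ b ∷ a ∷ []) ⊆ w)

module _ {A B : Set} (f : A → B) (f-injective : Injective _≡_ _≡_ f) where

  map-⊆⁻ : ∀ {xs ys} → map f xs ⊆ map f ys → xs ⊆ ys
  map-⊆⁻ p = Sublistʰ.map f-injective (Sublistʰ.map⁻ f f p)

  interlacedIn-map : ∀ u i j → InterlacedIn u i j ⇔ InterlacedIn (map f u) (f i) (f j)
  interlacedIn-map u i j = mk⇔
    (λ (i≢j , p) → (i≢j ∘ f-injective) , Sum.map (map⁺ f) (map⁺ f) p)
    (λ (fi≢fj , p) → (fi≢fj ∘ cong f) , Sum.map map-⊆⁻ map-⊆⁻ p)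

map-preimage : ∀ {A B : Set} (f : A → B) (w : List B) →
  (∀ b → b ∈ w → ∃ λ a → f a ≡ b) → ∃ λ u → map f u ≡ w
map-preimage f [] onto = [] , refl
map-preimage f (b ∷ w) onto with onto b (here refl) | map-preimage f w (λ b′ → onto b′ ∘ there)
... | a , refl | u , refl = a ∷ u , refl

rotations : ∀ {A : Set} → List A → List (List A)
rotations p = map (λ n → drop n p ++ take n p) (upTo (length p))

cyclicVariants : ∀ {A : Set} → List A → List (List A)
cyclicVariants p = rotations p ++ rotations (reverse p)

∈-rotations⁻ : ∀ {A : Set} {w p : List A} → w ∈ rotations p →
  ∃₂ λ xs ys → xs ++ ys ≡ p × ys ++ xs ≡ w
∈-rotations⁻ {p = p} w∈ with ∈-map⁻ (λ n → drop n p ++ take n p) w∈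
... | n , _ , refl = take n p , drop n p , take++drop≡id n p , refl

module _ {A : Set} (f : A → ℕ) where

  ∈-rotations⇒equivalent : ∀ {w p} → w ∈ rotations p → CyclicallyEquivalent (map f w) (map f p)
  ∈-rotations⇒equivalent w∈ with ∈-rotations⁻ w∈
  ... | xs , ys , refl , refl =
    subst₂ CyclicallyEquivalent (sym (map-++ f ys xs)) (sym (map-++ f xs ys))
      (rotate (map f ys) (map f xs) ◅ ε)

  ∈-cyclicVariants⇒equivalent : ∀ {w} p → w ∈ cyclicVariants p → CyclicallyEquivalent (map f w) (map f p)
  ∈-cyclicVariants⇒equivalent p w∈ with ∈-++⁻ (rotations p) w∈
  ... | inj₁ w∈rot = ∈-rotations⇒equivalent w∈rot
  ... | inj₂ w∈rot = ∈-rotations⇒equivalent w∈rot ◅◅ subst (CyclicallyEquivalent _) reverse-reverse (rev _ ◅ ε)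
    where
    reverse-reverse : reverse (map f (reverse p)) ≡ map f p
    reverse-reverse = trans (sym (reverse-map f (reverse p))) (cong (map f) (reverse-involutive p))

indicator : ∀ {c} → Fin c → Fin c → ℕ
indicator i x = if does (i ≟ x) then 1 else 0

occurrences : ∀ {c} → Fin c → List (Fin c) → ℕ
occurrences i [] = 0
occurrences i (x ∷ u) = indicator i x + occurrences i u

EachLetterTwice : ∀ {c} → List (Fin c) → Set
EachLetterTwice u = ∀ i → occurrences i u ≡ 2

indicator-diag : ∀ {c} (x : Fin c) → indicator x x ≡ 1
indicator-diag x = cong (if_then 1 else 0) (dec-true (x ≟ x) refl)

∑-indicator : ∀ {c} (x : Fin c) → sum (λ i → indicator i x) ≡ 1
∑-indicator {suc c} zero = cong suc (sum-replicate-zero c)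
∑-indicator {suc c} (suc x) = ∑-indicator x

∑-const : ∀ c k → sum {c} (λ _ → k) ≡ c * k
∑-const zero k = refl
∑-const (suc c) k = cong (k +_) (∑-const c k)

length-∑-occurrences : ∀ {c} (u : List (Fin c)) → length u ≡ sum (λ i → occurrences i u)
length-∑-occurrences {c} [] = sym (sum-replicate-zero c)
length-∑-occurrences (x ∷ u) = begin
  1 + length u                                            ≡⟨ cong₂ _+_ (sym (∑-indicator x)) (length-∑-occurrences u) ⟩
  sum (λ i → indicator i x) + sum (λ i → occurrences i u) ≡⟨ sym (∑-distrib-+ (λ i → indicator i x) (λ i → occurrences i u)) ⟩
  sum (λ i → occurrences i (x ∷ u))                       ∎
  where open ≡-Reasoning

length-eachLetterTwice : ∀ {c} (u : List (Fin c)) → EachLetterTwice u → length u ≡ c * 2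
length-eachLetterTwice {c} u twice =
  trans (length-∑-occurrences u) (trans (sum-cong-≗ twice) (∑-const c 2))

occurrences-ʳ++ : ∀ {c} (i : Fin c) acc s → occurrences i (acc ʳ++ s) ≡ occurrences i acc + occurrences i s
occurrences-ʳ++ i [] s = refl
occurrences-ʳ++ i (x ∷ acc) s =
  trans (occurrences-ʳ++ i acc (x ∷ s)) (x∙yz≈yx∙z (occurrences i acc) (indicator i x) (occurrences i s))

eachLetterTwice-prefix : ∀ {c} (acc : List (Fin c)) x s → EachLetterTwice (acc ʳ++ x ∷ s) → occurrences x acc < 2
eachLetterTwice-prefix acc x s twice = subst (occurrences x acc <_) total (m<m+n _ (s≤s z≤n))
  where
  open ≡-Reasoning
  total : occurrences x acc + suc (occurrences x s) ≡ 2
  total = begin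
    occurrences x acc + suc (occurrences x s)             ≡⟨ cong (λ n → occurrences x acc + (n + occurrences x s)) (sym (indicator-diag x)) ⟩
    occurrences x acc + (indicator x x + occurrences x s) ≡⟨ sym (occurrences-ʳ++ x acc (x ∷ s)) ⟩
    occurrences x (acc ʳ++ x ∷ s)                         ≡⟨ twice x ⟩
    2                                                     ∎

module _ {c} (v : Fin c → ℕ) (v-injective : Injective _≡_ _≡_ v) where

  count-map : ∀ i u → count (v i) (map v u) ≡ occurrences i u
  count-map i [] = refl
  count-map i (x ∷ u) with v i ℕ.≟ v x | i ≟ x
  ... | yes _ | yes _ = cong suc (count-map i u)
  ... | no _  | no _  = count-map i u
  ... | yes e | no ne = contradiction (v-injective e) ne
  ... | no ne | yes e = contradiction (cong v e) ne

module Exhaustive {c} {P : List (Fin c) → Set} (P? : Decidable P) where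

  -- The prefix `acc` is stored reversed; a letter is only appended while it occurs fewer than twice.
  allExtensions : ℕ → List (Fin c) → Bool
  allExtensions zero acc = does (P? (acc ʳ++ []))
  allExtensions (suc k) acc =
    all (λ x → if occurrences x acc <ᵇ 2 then allExtensions k (x ∷ acc) else true) (allFin c)

  allExtensions-sound : ∀ k acc → T (allExtensions k acc) →
    ∀ s → length s ≡ k → EachLetterTwice (acc ʳ++ s) → P (acc ʳ++ s)
  allExtensions-sound zero acc checked [] _ _ with P? (acc ʳ++ [])
  ... | yes holds = holds
  allExtensions-sound (suc k) acc checked (x ∷ s) len twice
    with occurrences x acc <ᵇ 2 in fresh | All.lookup (all⁺ _ _ checked) (∈-allFin x)
  ... | true  | checked′ = allExtensions-sound k (x ∷ acc) checked′ s (cong pred len) twice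
  ... | false | _ = ⊥-elim (subst T fresh (<⇒<ᵇ (eachLetterTwice-prefix acc x s twice)))

IsCycleInterlacement : ∀ c → List (Fin c) → Set
IsCycleInterlacement c u = ∀ i j → InterlacedIn u i j ⇔ CycleAdj c i j

record IsCycleAutomorphism c (σ : Fin c → Fin c) : Set where
  field
    injective : Injective _≡_ _≡_ σ
    surjective : ∀ i → ∃ λ j → σ j ≡ i
    adjacency : ∀ i j → CycleAdj c (σ i) (σ j) ⇔ CycleAdj c i j

isCycleLabelling-∘ : ∀ {c W v σ} → IsCycleLabelling c W v → IsCycleAutomorphism c σ →
  IsCycleLabelling c W (v ∘ σ)
isCycleLabelling-∘ {c} {W} {v} {σ} (v-injective , v∈W , onto , iso) aut =
  (injective ∘ v-injective) , (v∈W ∘ σ) , onto∘σ , λ i j → adjacency i j ⇔-∘ iso (σ i) (σ j)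
  where
  open IsCycleAutomorphism aut
  onto∘σ : ∀ a → a ∈ W → ∃ λ j → v (σ j) ≡ a
  onto∘σ a a∈W with onto a a∈W
  ... | i , refl with surjective i
  ... | j , refl = j , refl

symmetries : ∀ c → List (Fin c → Fin c)
symmetries zero = []
symmetries c@(suc _) = concatMap (λ k → rotation k ∷ rotation k ∘ opposite ∷ []) (upTo c)
  where
  rotation : ℕ → Fin c → Fin c
  rotation k i = (toℕ i + k) mod c

InNormalForm : ∀ c → List (Fin c) → Set
InNormalForm c u = Any (λ σ → u ∈ cyclicVariants (map σ (pattern' c))) (symmetries c)

cycleAdj? : ∀ c (i j : Fin c) → Dec (CycleAdj c i j)
cycleAdj? zero ()
cycleAdj? (suc c) i j = (toℕ j ℕ.≟ suc (toℕ i) % suc c) ⊎-dec (toℕ i ℕ.≟ suc (toℕ j) % suc c)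

interlacedIn? : ∀ {c} (u : List (Fin c)) i j → Dec (InterlacedIn u i j)
interlacedIn? u i j = ¬? (i ≟ j) ×-dec (((i ∷ j ∷ i ∷ j ∷ []) ⊆? u) ⊎-dec ((j ∷ i ∷ j ∷ i ∷ []) ⊆? u))
  where open DecSublist _≟_ using (_⊆?_)

isCycleInterlacement? : ∀ c u → Dec (IsCycleInterlacement c u)
isCycleInterlacement? c u = all? λ i → all? λ j → interlacedIn? u i j ⇔-dec cycleAdj? c i j

inNormalForm? : ∀ c u → Dec (InNormalForm c u)
inNormalForm? c u = Any.any? (λ σ → u ∈? cyclicVariants (map σ (pattern' c))) (symmetries c)
  where open DecMembership (≡-dec _≟_) using (_∈?_)

isCycleAutomorphism? : ∀ c σ → Dec (IsCycleAutomorphism c σ)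
isCycleAutomorphism? c σ = map′
  (λ (inj , surj , adj) → record { injective = λ {i} {j} → inj i j ; surjective = surj ; adjacency = adj })
  (λ aut → let open IsCycleAutomorphism aut in (λ i j → injective) , surjective , adjacency)
  (     (all? λ i → all? λ j → (σ i ≟ σ j) →-dec (i ≟ j))
  ×-dec (all? λ i → any? λ j → σ j ≟ i)
  ×-dec (all? λ i → all? λ j → cycleAdj? c (σ i) (σ j) ⇔-dec cycleAdj? c i j))

symmetries-automorphisms : ∀ {c} → c ≡ 3 ⊎ c ≡ 4 → All (IsCycleAutomorphism c) (symmetries c)
symmetries-automorphisms (inj₁ refl) = toWitness {a? = All.all? (isCycleAutomorphism? 3) (symmetries 3)} tt
symmetries-automorphisms (inj₂ refl) = toWitness {a? = All.all? (isCycleAutomorphism? 4) (symmetries 4)} tt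

isCycleInterlacement⇒inNormalForm : ∀ {c} → c ≡ 3 ⊎ c ≡ 4 → (u : List (Fin c)) →
  EachLetterTwice u → IsCycleInterlacement c u → InNormalForm c u
isCycleInterlacement⇒inNormalForm (inj₁ refl) u twice =
  allExtensions-sound 6 [] tt u (length-eachLetterTwice u twice) twice
  where open Exhaustive (λ u → isCycleInterlacement? 3 u →-dec inNormalForm? 3 u)
isCycleInterlacement⇒inNormalForm (inj₂ refl) u twice =
  allExtensions-sound 8 [] tt u (length-eachLetterTwice u twice) twice
  where open Exhaustive (λ u → isCycleInterlacement? 4 u →-dec inNormalForm? 4 u)

proposition15 : (c : ℕ) → (c ≡ 3 ⊎ c ≡ 4) → (W : Word) → DoubleOccurrence W →
    InterlacementIsCycle c W →
    ∃ λ (v : Fin c → ℕ) → IsCycleLabelling c W v × CyclicallyEquivalent W (map v (pattern' c))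
proposition15 c c∈ W double (v , labelling@(v-injective , v∈W , onto , iso)) with map-preimage v W onto
... | u , refl = v ∘ σ , isCycleLabelling-∘ labelling σ-automorphism , equivalent
  where
  twice : EachLetterTwice u
  twice i = trans (sym (count-map v v-injective i u)) (double (v i) (v∈W i))

  cycle : IsCycleInterlacement c u
  cycle i j = iso i j ⇔-∘ interlacedIn-map v v-injective u i j

  normalForm : InNormalForm c u
  normalForm = isCycleInterlacement⇒inNormalForm c∈ u twice cycle

  σ : Fin c → Fin c
  σ = Any.lookup normalForm

  found : IsCycleAutomorphism c σ × u ∈ cyclicVariants (map σ (pattern' c))
  found = All.lookupAny (symmetries-automorphisms c∈) normalForm

  σ-automorphism : IsCycleAutomorphism c σ
  σ-automorphism = proj₁ found

  equivalent : CyclicallyEquivalent (map v u) (map (v ∘ σ) (pattern' c))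
  equivalent = subst (CyclicallyEquivalent (map v u)) (sym (map-∘ (pattern' c)))
    (∈-cyclicVariants⇒equivalent v (map σ (pattern' c)) (proj₂ found))
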